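{- Let $L$ be a Lie ring and $H$ a subring of $L$. Then for all integers $0\le i<j$, $[H^i, C_L^j(H)]\subseteq C_L^{j-i-1}(H)$. In particular, for $i\ge1$, $[H^{i-1},C_L^i(H)]=0$.
   Context: $H^0=H$, $H^1=[H,H]$, $H^{n+1}=[H,H^n]$, where $[X,Y]$ denotes the additive subgroup generated by brackets $[x,y]$, $x\in X$, $y\in Y$. For $X\subseteq L$, $N_L(X)=\{x\in L:[x,X]\subseteq X\}$. Iterated centralizers: $C_L^0(H)=\{0\}$, $C_L^{n+1}(H)=\{x\in \bigcap_{1\le i\le n}N_L(C_L^i(H)) : [x,H]\subseteq C_L^n(H)\}$. -}

module Defs where

open import Level using (Level; _⊔_; Lift)
open import Algebra.Bundles using (AbelianGroup)
open import Data.Nat using (ℕ; zero; suc)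
open import Data.Product using (Σ; _×_; ∃-syntax)
open import Data.Unit.Polymorphic using (⊤)
open import Relation.Unary using (Pred; _∈_; _⊆_)

record LieRing (c ℓ : Level) : Set (Level.suc (c ⊔ ℓ)) where
  field
    abelianGroup : AbelianGroup c ℓ
  open AbelianGroup abelianGroup public
    renaming (_∙_ to _+_; ε to 0#; _⁻¹ to -_)
  field
    [_,_]      : Carrier → Carrier → Carrier
    bracket-cong : ∀ {x x′ y y′} → x ≈ x′ → y ≈ y′ → [ x , y ] ≈ [ x′ , y′ ]
    bracket-distribˡ : ∀ x y z → [ x , y + z ] ≈ [ x , y ] + [ x , z ]
    bracket-distribʳ : ∀ x y z → [ x + y , z ] ≈ [ x , z ] + [ y , z ]
    alternating : ∀ x → [ x , x ] ≈ 0#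
    jacobi : ∀ x y z → ([ x , [ y , z ] ] + [ y , [ z , x ] ]) + [ z , [ x , y ] ] ≈ 0#

module LieTheory {c ℓ : Level} (L : LieRing c ℓ) where
  open LieRing L

  Subset : Set (Level.suc (c ⊔ ℓ))
  Subset = Pred Carrier (c ⊔ ℓ)

  record IsSubring (H : Subset) : Set (c ⊔ ℓ) where
    field
      ∈-resp-≈ : ∀ {x y} → x ≈ y → x ∈ H → y ∈ H
      0∈   : 0# ∈ H
      +∈   : ∀ {x y} → x ∈ H → y ∈ H → (x + y) ∈ H
      -∈   : ∀ {x} → x ∈ H → (- x) ∈ H
      [,]∈ : ∀ {x y} → x ∈ H → y ∈ H → [ x , y ] ∈ H

  data Span (P : Subset) : Subset where
    gen  : ∀ {x} → x ∈ P → x ∈ Span P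
    zero : 0# ∈ Span P
    plus : ∀ {x y} → x ∈ Span P → y ∈ Span P → (x + y) ∈ Span P
    neg  : ∀ {x} → x ∈ Span P → (- x) ∈ Span P
    resp : ∀ {x y} → x ≈ y → x ∈ Span P → y ∈ Span P

  Br : Subset → Subset → Subset
  Br X Y = Span (λ z → ∃[ x ] ∃[ y ] (x ∈ X × y ∈ Y × z ≈ [ x , y ]))

  ｛_｝ : Carrier → Subset
  ｛ x ｝ = λ y → Lift c (y ≈ x)

  Zero : Subset
  Zero = ｛ 0# ｝

  Pow : Subset → ℕ → Subset
  Pow H zero    = H
  Pow H (suc n) = Br H (Pow H n)

  N : Subset → Subset
  N X = λ x → Br ｛ x ｝ X ⊆ X

  -- iterated centralizers C^n_L(H), together with
  -- NormAll H n = ⋂_{1 ≤ i ≤ n} N_L(C^i_L(H))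
  mutual
    C : Subset → ℕ → Subset
    C H zero    = Zero
    C H (suc n) = λ x → NormAll H n x × Br ｛ x ｝ H ⊆ C H n

    NormAll : Subset → ℕ → Subset
    NormAll H zero    = λ _ → ⊤
    NormAll H (suc n) = λ x → NormAll H n x × x ∈ N (C H (suc n))

-- By Jacobi, [[h,y],x] = [h,[y,x]] + [y,[x,h]].  If y ∈ H^i and x ∈ C^{i+k+2}, then by induction
-- on i the first summand lies in [H, C^{k+1}] ⊆ C^k and the second in [H^i, C^{i+k+1}] ⊆ C^k;
-- since C^k is an additive subgroup this covers all of [H^{i+1}, C^{i+k+2}].  Only the clause
-- [x,H] ⊆ C^{n} of C^{n+1} is ever used: neither the normalizer conditions nor the subring
-- hypothesis on H play a role.
module Submission where

open import Defs
open import Level using (Level; _⊔_; lift)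
open import Data.Nat using (ℕ; zero; suc; _<_; _≤_; _∸_; s≤s) renaming (_+_ to _+ℕ_)
open import Data.Nat.Properties using (+-suc; m+n∸n≡m; n<1+n)
open import Data.Product using (_×_; _,_; ∃-syntax)
open import Relation.Unary using (_∈_; _⊆_)
open import Relation.Binary.PropositionalEquality as ≡ using (_≡_)
import Algebra.Properties.Group as GroupProperties
import Algebra.Properties.Loop as LoopProperties
import Relation.Binary.Reasoning.Setoid as SetoidReasoning

+-suc-∸-∸ : ∀ {i j} → i < j → i +ℕ suc (j ∸ i ∸ 1) ≡ j
+-suc-∸-∸ {zero}  {suc j} _         = ≡.refl
+-suc-∸-∸ {suc i} {suc j} (s≤s i<j) = ≡.cong suc (+-suc-∸-∸ i<j)

module LieRingProperties {c ℓ : Level} (L : LieRing c ℓ) where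
  open LieRing L
  open GroupProperties group using (inverseʳ-unique; ε⁻¹≈ε; loop)
  open LoopProperties loop using (identityʳ-unique)
  open SetoidReasoning setoid

  bracket-zeroˡ : ∀ x → [ 0# , x ] ≈ 0#
  bracket-zeroˡ x = identityʳ-unique [ 0# , x ] [ 0# , x ]
    (trans (sym (bracket-distribʳ 0# 0# x)) (bracket-cong (identityʳ 0#) refl))

  bracket-negˡ : ∀ x y → [ - x , y ] ≈ - [ x , y ]
  bracket-negˡ x y = inverseʳ-unique [ x , y ] [ - x , y ]
    (trans (sym (bracket-distribʳ x (- x) y))
           (trans (bracket-cong (inverseʳ x) refl) (bracket-zeroˡ y)))

  bracket-antisym : ∀ x y → [ y , x ] ≈ - [ x , y ]
  bracket-antisym x y = inverseʳ-unique [ x , y ] [ y , x ] (begin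
    [ x , y ] + [ y , x ]                 ≈⟨ ∙-cong (sym [x,x+y]≈[x,y]) (sym [y,x+y]≈[y,x]) ⟩
    [ x , x + y ] + [ y , x + y ]         ≈⟨ sym (bracket-distribʳ x y (x + y)) ⟩
    [ x + y , x + y ]                     ≈⟨ alternating (x + y) ⟩
    0#                                    ∎)
    where
    [x,x+y]≈[x,y] : [ x , x + y ] ≈ [ x , y ]
    [x,x+y]≈[x,y] = trans (bracket-distribˡ x x y) (trans (∙-congʳ (alternating x)) (identityˡ _))
    [y,x+y]≈[y,x] : [ y , x + y ] ≈ [ y , x ]
    [y,x+y]≈[y,x] = trans (bracket-distribˡ y x y) (trans (∙-congˡ (alternating y)) (identityʳ _))

  jacobi-expand : ∀ x y z → [ [ x , y ] , z ] ≈ [ x , [ y , z ] ] + [ y , [ z , x ] ]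
  jacobi-expand x y z = begin
    [ [ x , y ] , z ]                     ≈⟨ bracket-antisym z [ x , y ] ⟩
    - [ z , [ x , y ] ]                   ≈⟨ sym (inverseʳ-unique _ _ (trans (sym (assoc _ _ _)) (jacobi z x y))) ⟩
    [ x , [ y , z ] ] + [ y , [ z , x ] ] ∎

  open LieTheory L

  record IsAdditiveSubgroup (S : Subset) : Set (c ⊔ ℓ) where
    field
      ∈-resp-≈ : ∀ {x y} → x ≈ y → x ∈ S → y ∈ S
      0∈       : 0# ∈ S
      +∈       : ∀ {x y} → x ∈ S → y ∈ S → (x + y) ∈ S
      -∈       : ∀ {x} → x ∈ S → (- x) ∈ S
  open IsAdditiveSubgroup

  Brackets : Subset → Subset → Subset
  Brackets X Y z = ∃[ x ] ∃[ y ] (x ∈ X × y ∈ Y × z ≈ [ x , y ])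

  Zero⊆Span : ∀ {P : Subset} → Zero ⊆ Span P
  Zero⊆Span (lift z≈0) = resp (sym z≈0) zero

  Span-minimal : ∀ {P T : Subset} → IsAdditiveSubgroup T → P ⊆ T → Span P ⊆ T
  Span-minimal T P⊆T (gen p)    = P⊆T p
  Span-minimal T P⊆T zero       = 0∈ T
  Span-minimal T P⊆T (plus p q) = +∈ T (Span-minimal T P⊆T p) (Span-minimal T P⊆T q)
  Span-minimal T P⊆T (neg p)    = -∈ T (Span-minimal T P⊆T p)
  Span-minimal T P⊆T (resp e p) = ∈-resp-≈ T e (Span-minimal T P⊆T p)

  Br-⊆ : ∀ {X Y T : Subset} → IsAdditiveSubgroup T →
         (∀ {x y} → x ∈ X → y ∈ Y → [ x , y ] ∈ T) → Br X Y ⊆ T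
  Br-⊆ T f = Span-minimal T λ { (_ , _ , x∈X , y∈Y , e) → ∈-resp-≈ T (sym e) (f x∈X y∈Y) }

  Br-singleton-⊆ : ∀ {x} {S T : Subset} → IsAdditiveSubgroup T →
                   (∀ {s} → s ∈ S → [ x , s ] ∈ T) → Br ｛ x ｝ S ⊆ T
  Br-singleton-⊆ T f = Br-⊆ T λ { (lift e) s∈S → ∈-resp-≈ T (bracket-cong (sym e) refl) (f s∈S) }

  Br-singleton-∈ : ∀ {x s} {S T : Subset} → Br ｛ x ｝ S ⊆ T → s ∈ S → [ x , s ] ∈ T
  Br-singleton-∈ {x} {s} q s∈S = q (gen (x , s , lift refl , s∈S , refl))

  Zero-isAdditiveSubgroup : IsAdditiveSubgroup Zero
  ∈-resp-≈ Zero-isAdditiveSubgroup e (lift x≈0)           = lift (trans (sym e) x≈0)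
  0∈       Zero-isAdditiveSubgroup                        = lift refl
  +∈       Zero-isAdditiveSubgroup (lift x≈0) (lift y≈0)  = lift (trans (∙-cong x≈0 y≈0) (identityʳ 0#))
  -∈       Zero-isAdditiveSubgroup (lift x≈0)             = lift (trans (⁻¹-cong x≈0) ε⁻¹≈ε)

  ∩-isAdditiveSubgroup : ∀ {A B : Subset} → IsAdditiveSubgroup A → IsAdditiveSubgroup B →
                         IsAdditiveSubgroup (λ x → x ∈ A × x ∈ B)
  ∈-resp-≈ (∩-isAdditiveSubgroup A B) e (a , b)         = ∈-resp-≈ A e a , ∈-resp-≈ B e b
  0∈       (∩-isAdditiveSubgroup A B)                   = 0∈ A , 0∈ B
  +∈       (∩-isAdditiveSubgroup A B) (a , b) (a′ , b′) = +∈ A a a′ , +∈ B b b′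
  -∈       (∩-isAdditiveSubgroup A B) (a , b)           = -∈ A a , -∈ B b

  bracket-preimageˡ-isAdditiveSubgroup : ∀ {T : Subset} z → IsAdditiveSubgroup T →
                                         IsAdditiveSubgroup (λ y → [ y , z ] ∈ T)
  ∈-resp-≈ (bracket-preimageˡ-isAdditiveSubgroup z T) e p = ∈-resp-≈ T (bracket-cong e refl) p
  0∈       (bracket-preimageˡ-isAdditiveSubgroup z T)     = ∈-resp-≈ T (sym (bracket-zeroˡ z)) (0∈ T)
  +∈       (bracket-preimageˡ-isAdditiveSubgroup z T) p q =
    ∈-resp-≈ T (sym (bracket-distribʳ _ _ z)) (+∈ T p q)
  -∈       (bracket-preimageˡ-isAdditiveSubgroup z T) p   = ∈-resp-≈ T (sym (bracket-negˡ _ z)) (-∈ T p)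

  Br-singleton-isAdditiveSubgroup : ∀ {S T : Subset} → IsAdditiveSubgroup T →
                                    IsAdditiveSubgroup (λ x → Br ｛ x ｝ S ⊆ T)
  Br-singleton-isAdditiveSubgroup {S} {T} T-sub = record
    { ∈-resp-≈ = λ e q → Br-singleton-⊆ T-sub λ s∈S → ∈-resp-≈ (preimage _) e (Br-singleton-∈ q s∈S)
    ; 0∈       = Br-singleton-⊆ T-sub λ _ → 0∈ (preimage _)
    ; +∈       = λ p q → Br-singleton-⊆ T-sub λ s∈S →
                   +∈ (preimage _) (Br-singleton-∈ p s∈S) (Br-singleton-∈ q s∈S)
    ; -∈       = λ p → Br-singleton-⊆ T-sub λ s∈S → -∈ (preimage _) (Br-singleton-∈ p s∈S)
    }
    where
    preimage : ∀ s → IsAdditiveSubgroup (λ y → [ y , s ] ∈ T)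
    preimage s = bracket-preimageˡ-isAdditiveSubgroup s T-sub

  module Centralizers (H : Subset) where
    mutual
      C-isAdditiveSubgroup : ∀ n → IsAdditiveSubgroup (C H n)
      C-isAdditiveSubgroup zero    = Zero-isAdditiveSubgroup
      C-isAdditiveSubgroup (suc n) =
        ∩-isAdditiveSubgroup (NormAll-isAdditiveSubgroup n)
                             (Br-singleton-isAdditiveSubgroup (C-isAdditiveSubgroup n))

      NormAll-isAdditiveSubgroup : ∀ n → IsAdditiveSubgroup (NormAll H n)
      NormAll-isAdditiveSubgroup zero    = record
        { ∈-resp-≈ = λ _ _ → _ ; 0∈ = _ ; +∈ = λ _ _ → _ ; -∈ = λ _ → _ }
      NormAll-isAdditiveSubgroup (suc n) =
        ∩-isAdditiveSubgroup (NormAll-isAdditiveSubgroup n)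
                             (Br-singleton-isAdditiveSubgroup (C-isAdditiveSubgroup (suc n)))

    C-suc-bracketʳ : ∀ k {x h} → x ∈ C H (suc k) → h ∈ H → [ x , h ] ∈ C H k
    C-suc-bracketʳ k (_ , [x,H]⊆C) h∈H = Br-singleton-∈ [x,H]⊆C h∈H

    C-suc-bracketˡ : ∀ k {h x} → h ∈ H → x ∈ C H (suc k) → [ h , x ] ∈ C H k
    C-suc-bracketˡ k h∈H x∈C = ∈-resp-≈ (C-isAdditiveSubgroup k) (sym (bracket-antisym _ _))
                                 (-∈ (C-isAdditiveSubgroup k) (C-suc-bracketʳ k x∈C h∈H))

    Pow-bracket-C : ∀ i k {y x} → y ∈ Pow H i → x ∈ C H (i +ℕ suc k) → [ y , x ] ∈ C H k
    Pow-bracket-C zero    k y∈H x∈C = C-suc-bracketˡ k y∈H x∈C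
    Pow-bracket-C (suc i) k {x = x} y∈Pow x∈C =
      Span-minimal (bracket-preimageˡ-isAdditiveSubgroup x (C-isAdditiveSubgroup k)) generator y∈Pow
      where
      x∈C′ : x ∈ C H (i +ℕ suc (suc k))
      x∈C′ = ≡.subst (λ n → x ∈ C H n) (≡.sym (+-suc i (suc k))) x∈C

      generator : Brackets H (Pow H i) ⊆ (λ z → [ z , x ] ∈ C H k)
      generator (h , y , h∈H , y∈Pow , z≈[h,y]) =
        ∈-resp-≈ (C-isAdditiveSubgroup k)
                 (sym (trans (bracket-cong z≈[h,y] refl) (jacobi-expand h y x)))
                 (+∈ (C-isAdditiveSubgroup k)
                     (C-suc-bracketˡ k h∈H (Pow-bracket-C i (suc k) y∈Pow x∈C′))
                     (Pow-bracket-C i k y∈Pow (C-suc-bracketʳ (i +ℕ suc k) x∈C h∈H)))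

    Br-Pow-C⊆C : ∀ i j → i < j → Br (Pow H i) (C H j) ⊆ C H (j ∸ i ∸ 1)
    Br-Pow-C⊆C i j i<j = Br-⊆ (C-isAdditiveSubgroup (j ∸ i ∸ 1)) λ y∈Pow x∈C →
      Pow-bracket-C i (j ∸ i ∸ 1) y∈Pow (≡.subst (λ n → _ ∈ C H n) (≡.sym (+-suc-∸-∸ i<j)) x∈C)

    Br-Pow-C-vanishes : ∀ n → Br (Pow H n) (C H (suc n)) ⊆ Zero
    Br-Pow-C-vanishes n {z} z∈Br =
      ≡.subst (λ m → z ∈ C H m) (≡.cong (_∸ 1) (m+n∸n≡m 1 n)) (Br-Pow-C⊆C n (suc n) (n<1+n n) z∈Br)

mainTheorem5 : ∀ {c ℓ : Level} (L : LieRing c ℓ) (H : LieTheory.Subset L) →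
    LieTheory.IsSubring L H →
    ((i j : ℕ) → i < j →
      LieTheory.Br L (LieTheory.Pow L H i) (LieTheory.C L H j)
        ⊆ LieTheory.C L H (j ∸ i ∸ 1))
    × ((i : ℕ) → 1 ≤ i →
      (LieTheory.Br L (LieTheory.Pow L H (i ∸ 1)) (LieTheory.C L H i) ⊆ LieTheory.Zero L)
      × (LieTheory.Zero L ⊆ LieTheory.Br L (LieTheory.Pow L H (i ∸ 1)) (LieTheory.C L H i)))
mainTheorem5 L H _ = Br-Pow-C⊆C , λ { (suc n) _ → Br-Pow-C-vanishes n , Zero⊆Span }
  where
  open LieRingProperties L
  open Centralizers H
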